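{- Let $q$ be any prime power, let $\mathcal C$ be a system of representatives of the cosets of $(\mathbb F_q^*)^{(3)}=\{x^3:x\in\mathbb F_q^*\}$ in $\mathbb F_q^*$, and let $t,t'\in\mathcal C$. If $\frac{X^3+t}{X}$ and $\frac{X^3+t'}{X}$ are equivalent, then $t=t'$.
   Context: $\mathbb F_q$ is the field with $q$ elements. $\mathrm{PGL}(2,\mathbb F_q)$ is the group (under composition) of rational functions $(aX+b)/(cX+d)$, $a,b,c,d\in\mathbb F_q$, $ad-bc\neq0$. Two nonconstant $f,g\in\mathbb F_q(X)$ are equivalent if $g=\psi\circ f\circ\phi$ for some $\psi,\phi\in\mathrm{PGL}(2,\mathbb F_q)$. -}

module Defs where

open import Level using (Level; _⊔_) renaming (suc to lsuc)
open import Algebra.Bundles using (CommutativeRing)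
open import Data.Nat using (ℕ; zero; suc)
open import Data.Fin using (Fin)
open import Data.List using (List; []; _∷_; map)
open import Data.Product using (Σ; _×_; _,_; ∃; ∃-syntax)
open import Relation.Nullary using (¬_; Dec)

record FiniteField (c ℓ : Level) : Set (lsuc (c ⊔ ℓ)) where
  field
    commRing  : CommutativeRing c ℓ
  open CommutativeRing commRing public
  field
    0≉1       : ¬ (0# ≈ 1#)
    inverse   : ∀ x → ¬ (x ≈ 0#) → Σ Carrier (λ y → x * y ≈ 1#)
    _≟_       : ∀ x y → Dec (x ≈ y)
    size      : ℕ
    enum      : Fin size → Carrier
    enum-surj : ∀ x → Σ (Fin size) (λ i → enum i ≈ x)

module RatFun {c ℓ : Level} (F : FiniteField c ℓ) where
  open FiniteField F public

  -- Polynomials in F[X]: coefficient lists, lowest degree first.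
  Poly : Set c
  Poly = List Carrier

  coeff : Poly → ℕ → Carrier
  coeff []       _       = 0#
  coeff (a ∷ p)  zero    = a
  coeff (a ∷ p)  (suc n) = coeff p n

  _≈ₚ_ : Poly → Poly → Set ℓ
  p ≈ₚ q = ∀ n → coeff p n ≈ coeff q n

  _+ₚ_ : Poly → Poly → Poly
  []      +ₚ q       = q
  (a ∷ p) +ₚ []      = a ∷ p
  (a ∷ p) +ₚ (b ∷ q) = (a + b) ∷ (p +ₚ q)

  _*ₚ_ : Poly → Poly → Poly
  []      *ₚ q = []
  (a ∷ p) *ₚ q = map (a *_) q +ₚ (0# ∷ (p *ₚ q))

  constₚ : Carrier → Poly
  constₚ a = a ∷ []

  -- Elements of F(X), as fractions num / den (den ≠ 0 where relevant).
  Frac : Set c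
  Frac = Poly × Poly

  num den : Frac → Poly
  num (n , _) = n
  den (_ , d) = d

  _≈ᶠ_ : Frac → Frac → Set ℓ
  f ≈ᶠ g = (num f *ₚ den g) ≈ₚ (num g *ₚ den f)

  constᶠ : Carrier → Frac
  constᶠ a = constₚ a , constₚ 1#

  _+ᶠ_ : Frac → Frac → Frac
  (a , b) +ᶠ (c' , d) = ((a *ₚ d) +ₚ (c' *ₚ b)) , (b *ₚ d)

  _*ᶠ_ : Frac → Frac → Frac
  (a , b) *ᶠ (c' , d) = (a *ₚ c') , (b *ₚ d)

  _/ᶠ_ : Frac → Frac → Frac
  (a , b) /ᶠ (c' , d) = (a *ₚ d) , (b *ₚ c')

  evalᶠ : Poly → Frac → Frac
  evalᶠ []      g = constᶠ 0#
  evalᶠ (a ∷ p) g = constᶠ a +ᶠ (g *ᶠ evalᶠ p g)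

  _∘ᶠ_ : Frac → Frac → Frac
  f ∘ᶠ g = evalᶠ (num f) g /ᶠ evalᶠ (den f) g

  record Mobius : Set (c ⊔ ℓ) where
    constructor mob
    field
      a b c' d : Carrier
      nondeg   : ¬ ((a * d - b * c') ≈ 0#)

  toFrac : Mobius → Frac
  toFrac (mob a b c' d _) = (b ∷ a ∷ []) , (d ∷ c' ∷ [])

  Equivalent : Frac → Frac → Set (c ⊔ ℓ)
  Equivalent f g = Σ Mobius λ ψ → Σ Mobius λ φ →
    g ≈ᶠ (toFrac ψ ∘ᶠ (f ∘ᶠ toFrac φ))

  cubicFrac : Carrier → Frac
  cubicFrac t = (t ∷ 0# ∷ 0# ∷ 1# ∷ []) , (0# ∷ 1# ∷ [])

  cube : Carrier → Carrier
  cube y = y * (y * y)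

  SameCubeCoset : Carrier → Carrier → Set (c ⊔ ℓ)
  SameCubeCoset x x' = Σ Carrier λ y → ¬ (y ≈ 0#) × (x' ≈ x * cube y)

  record CubeCosetReps {p : Level} (𝒞 : Carrier → Set p) : Set (c ⊔ ℓ ⊔ p) where
    field
      reps-nonzero : ∀ x → 𝒞 x → ¬ (x ≈ 0#)
      reps-cover   : ∀ x → ¬ (x ≈ 0#) → Σ Carrier λ r → 𝒞 r × SameCubeCoset r x
      reps-unique  : ∀ r r' → 𝒞 r → 𝒞 r' → SameCubeCoset r r' → r ≈ r'

{-# OPTIONS --safe #-}
module Submission where

open import Defs
open import Level using (Level)
open import Data.Nat as ℕ using (ℕ; zero; suc)
open import Data.List using (List; []; _∷_; map)
open import Data.Product using (_×_; _,_; proj₁; proj₂)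
open import Function using (_∘_)
open import Relation.Nullary using (¬_; yes; no; contradiction)
open import Relation.Binary.Structures using (IsEquivalence)
open import Relation.Binary.Bundles using (Setoid)
open import Algebra.Bundles using (CommutativeSemiring)
open import Algebra.Structures.Biased using (IsCommutativeSemiringʳ; isCommutativeMonoidˡ)
import Relation.Binary.Reasoning.Setoid as SetoidReasoning
import Algebra.Properties.Ring as RingProperties
import Algebra.Properties.CommutativeSemigroup as CommutativeSemigroupProperties
import Algebra.Solver.Ring.NaturalCoefficients.Default as NaturalCoefficientsSolver

-- Write φ = (aX + b)/(cX + d) and ψ = (AX + B)/(CX + D), and f = (X³ + t)/X.  Then
-- f ∘ φ = G/H with G = (aX + b)³ + t (cX + d)³ and H = (aX + b)(cX + d)², so
-- ψ ∘ f ∘ φ = (AG + BH)/(CG + DH) up to a nonzero common factor.  If this equals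
-- (X³ + t')/X, comparing coefficients of these polynomials of degree ≤ 3 puts AG + BH
-- and CG + DH in the span of X and X³ + t'; as ψ is invertible, so are G and H: their
-- X² coefficients vanish and their constant terms are t' times their X³ coefficients.
-- These four equations give t' a³ = t e³ with e = d if c = 0 and e = -d otherwise, so
-- t and t' represent the same coset of (F*)³ and are equal.

-- The operations of Defs on coefficient lists and on fractions, over an arbitrary carrier
-- (for fractions A stands for polynomials, and a coefficient x for constₚ x).  Instantiated
-- with the syntax of the semiring solver, the denotation of such an expression is
-- definitionally the corresponding expression of Defs, so the solver applies to the latter.
module Syntax {a} {A : Set a} (0ᴬ 1ᴬ : A) (_⊕_ _⊗_ : A → A → A) where

  cubeᴬ : A → A
  cubeᴬ x = x ⊗ (x ⊗ x)

  _+ˢ_ : List A → List A → List A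
  []      +ˢ q       = q
  (x ∷ p) +ˢ []      = x ∷ p
  (x ∷ p) +ˢ (y ∷ q) = (x ⊕ y) ∷ (p +ˢ q)

  _*ˢ_ : List A → List A → List A
  []      *ˢ q = []
  (x ∷ p) *ˢ q = map (x ⊗_) q +ˢ (0ᴬ ∷ (p *ˢ q))

  cubeˢ : List A → List A
  cubeˢ p = p *ˢ (p *ˢ p)

  coeffˢ : List A → ℕ → A
  coeffˢ []      _       = 0ᴬ
  coeffˢ (x ∷ p) zero    = x
  coeffˢ (x ∷ p) (suc n) = coeffˢ p n

  Fracˢ : Set a
  Fracˢ = A × A

  constᶠˢ : A → Fracˢ
  constᶠˢ x = x , 1ᴬ

  _+ᶠˢ_ _*ᶠˢ_ _/ᶠˢ_ : Fracˢ → Fracˢ → Fracˢ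
  (n₁ , d₁) +ᶠˢ (n₂ , d₂) = (n₁ ⊗ d₂) ⊕ (n₂ ⊗ d₁) , d₁ ⊗ d₂
  (n₁ , d₁) *ᶠˢ (n₂ , d₂) = n₁ ⊗ n₂ , d₁ ⊗ d₂
  (n₁ , d₁) /ᶠˢ (n₂ , d₂) = n₁ ⊗ d₂ , d₁ ⊗ n₂

  evalᶠˢ : List A → Fracˢ → Fracˢ
  evalᶠˢ []      g = constᶠˢ 0ᴬ
  evalᶠˢ (x ∷ p) g = constᶠˢ x +ᶠˢ (g *ᶠˢ evalᶠˢ p g)

  _∘ᶠˢ_ : List A × List A → Fracˢ → Fracˢ
  (n , d) ∘ᶠˢ g = evalᶠˢ n g /ᶠˢ evalᶠˢ d g

module FieldProperties {c ℓ : Level} (F : FiniteField c ℓ) where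
  open RatFun F
  open RingProperties ring using ([y-z]x≈yx-zx)
  open SetoidReasoning setoid
  open NaturalCoefficientsSolver commutativeSemiring using (solve; _:+_; _:*_; _:=_)

  inverse-cancelˡ : ∀ {x x⁻¹} y → x * x⁻¹ ≈ 1# → x⁻¹ * (x * y) ≈ y
  inverse-cancelˡ {x} {x⁻¹} y xx⁻¹≈1 = begin
    x⁻¹ * (x * y)  ≈⟨ *-assoc x⁻¹ x y ⟨
    (x⁻¹ * x) * y  ≈⟨ *-congʳ (trans (*-comm x⁻¹ x) xx⁻¹≈1) ⟩
    1# * y         ≈⟨ *-identityˡ y ⟩
    y              ∎

  *-cancelˡ : ∀ {x y z} → x ≉ 0# → x * y ≈ x * z → y ≈ z
  *-cancelˡ {x} {y} {z} x≉0 xy≈xz with inverse x x≉0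
  ... | x⁻¹ , xx⁻¹≈1 = begin
    y              ≈⟨ inverse-cancelˡ y xx⁻¹≈1 ⟨
    x⁻¹ * (x * y)  ≈⟨ *-congˡ xy≈xz ⟩
    x⁻¹ * (x * z)  ≈⟨ inverse-cancelˡ z xx⁻¹≈1 ⟩
    z              ∎

  x*y≈0⇒y≈0 : ∀ {x y} → x ≉ 0# → x * y ≈ 0# → y ≈ 0#
  x*y≈0⇒y≈0 {x} x≉0 xy≈0 = *-cancelˡ x≉0 (trans xy≈0 (sym (zeroʳ x)))

  x≈0⇒x*y≈0 : ∀ {x y} → x ≈ 0# → x * y ≈ 0#
  x≈0⇒x*y≈0 {x} {y} x≈0 = trans (*-congʳ x≈0) (zeroˡ y)

  y≈0⇒x*y≈0 : ∀ {x y} → y ≈ 0# → x * y ≈ 0#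
  y≈0⇒x*y≈0 {x} {y} y≈0 = trans (*-congˡ y≈0) (zeroʳ x)

  x*y≈0⇒x≈0 : ∀ {x y} → y ≉ 0# → x * y ≈ 0# → x ≈ 0#
  x*y≈0⇒x≈0 {x} {y} y≉0 xy≈0 = x*y≈0⇒y≈0 y≉0 (trans (*-comm y x) xy≈0)

  *-nonzero : ∀ {x y} → x ≉ 0# → y ≉ 0# → x * y ≉ 0#
  *-nonzero x≉0 y≉0 xy≈0 = y≉0 (x*y≈0⇒y≈0 x≉0 xy≈0)

  x*y≉0⇒x≉0 : ∀ {x y} → x * y ≉ 0# → x ≉ 0#
  x*y≉0⇒x≉0 xy≉0 = xy≉0 ∘ x≈0⇒x*y≈0

  x*y≉0⇒y≉0 : ∀ {x y} → x * y ≉ 0# → y ≉ 0#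
  x*y≉0⇒y≉0 xy≉0 = xy≉0 ∘ y≈0⇒x*y≈0

  x≈0⇒x*y+z≈z : ∀ {x} y z → x ≈ 0# → x * y + z ≈ z
  x≈0⇒x*y+z≈z y z x≈0 = trans (+-congʳ (x≈0⇒x*y≈0 x≈0)) (+-identityˡ z)

  y≈0⇒x*y+z≈z : ∀ x {y} z → y ≈ 0# → x * y + z ≈ z
  y≈0⇒x*y+z≈z x z y≈0 = trans (+-congʳ (y≈0⇒x*y≈0 y≈0)) (+-identityˡ z)

  y≈0⇒x+y≈x : ∀ {x y} → y ≈ 0# → x + y ≈ x
  y≈0⇒x+y≈x {x} y≈0 = trans (+-congˡ y≈0) (+-identityʳ x)

  x+w≈z+y⇒x-y≈z-w : ∀ {x y z w} → x + w ≈ z + y → x - y ≈ z - w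
  x+w≈z+y⇒x-y≈z-w {x} {y} {z} {w} eq = begin
    x - y                      ≈⟨ +-identityʳ _ ⟨
    (x - y) + 0#               ≈⟨ +-congˡ (-‿inverseʳ w) ⟨
    (x - y) + (w - w)          ≈⟨ solve 4 (λ x w -y -w → (x :+ -y) :+ (w :+ -w) := (x :+ w) :+ (-y :+ -w)) refl x w (- y) (- w) ⟩
    (x + w) + (- y - w)        ≈⟨ +-congʳ eq ⟩
    (z + y) + (- y - w)        ≈⟨ solve 4 (λ z y -y -w → (z :+ y) :+ (-y :+ -w) := (z :+ -w) :+ (y :+ -y)) refl z y (- y) (- w) ⟩
    (z - w) + (y - y)          ≈⟨ +-congˡ (-‿inverseʳ y) ⟩
    (z - w) + 0#               ≈⟨ +-identityʳ _ ⟩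
    z - w                      ∎

  det*x≈adjugate : ∀ A B C D x y → (A * D - B * C) * x ≈ D * (A * x + B * y) - B * (C * x + D * y)
  det*x≈adjugate A B C D x y = trans ([y-z]x≈yx-zx x (A * D) (B * C)) (x+w≈z+y⇒x-y≈z-w
    (solve 6 (λ A B C D x y → (A :* D) :* x :+ B :* (C :* x :+ D :* y) := D :* (A :* x :+ B :* y) :+ (B :* C) :* x) refl A B C D x y))

  det*y≈adjugate : ∀ A B C D x y → (A * D - B * C) * y ≈ A * (C * x + D * y) - C * (A * x + B * y)
  det*y≈adjugate A B C D x y = trans ([y-z]x≈yx-zx y (A * D) (B * C)) (x+w≈z+y⇒x-y≈z-w
    (solve 6 (λ A B C D x y → (A :* D) :* y :+ C :* (A :* x :+ B :* y) := A :* (C :* x :+ D :* y) :+ (B :* C) :* y) refl A B C D x y))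

  linear-injective : ∀ {A B C D x y x' y'} → A * D - B * C ≉ 0# →
    A * x + B * y ≈ A * x' + B * y' → C * x + D * y ≈ C * x' + D * y' → x ≈ x' × y ≈ y'
  linear-injective {A} {B} {C} {D} {x} {y} {x'} {y'} det≉0 eq₁ eq₂ =
    *-cancelˡ det≉0 (begin
      (A * D - B * C) * x                            ≈⟨ det*x≈adjugate A B C D x y ⟩
      D * (A * x + B * y) - B * (C * x + D * y)      ≈⟨ +-cong (*-congˡ eq₁) (-‿cong (*-congˡ eq₂)) ⟩
      D * (A * x' + B * y') - B * (C * x' + D * y')  ≈⟨ det*x≈adjugate A B C D x' y' ⟨
      (A * D - B * C) * x'                           ∎) ,
    *-cancelˡ det≉0 (begin
      (A * D - B * C) * y                            ≈⟨ det*y≈adjugate A B C D x y ⟩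
      A * (C * x + D * y) - C * (A * x + B * y)      ≈⟨ +-cong (*-congˡ eq₂) (-‿cong (*-congˡ eq₁)) ⟩
      A * (C * x' + D * y') - C * (A * x' + B * y')  ≈⟨ det*y≈adjugate A B C D x' y' ⟨
      (A * D - B * C) * y'                           ∎)

module CubeCosets {c ℓ : Level} (F : FiniteField c ℓ) where
  open RatFun F
  open FieldProperties F
  open RingProperties ring using (-‿distribˡ-*; -‿distribʳ-*; -‿involutive; -0#≈0#; +-inverseˡ-unique)
  open SetoidReasoning setoid
  open NaturalCoefficientsSolver commutativeSemiring using (solve; con; _:+_; _:*_; _:=_)

  2# 3# : Carrier
  2# = 1# + 1#
  3# = 2# + 1#

  cube-neg : ∀ x → cube (- x) ≈ - cube x
  cube-neg x = begin
    - x * (- x * - x)  ≈⟨ *-congˡ -x*-x≈x*x ⟩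
    - x * (x * x)      ≈⟨ -‿distribˡ-* x (x * x) ⟨
    - (x * (x * x))    ∎
    where
    -x*-x≈x*x : - x * - x ≈ x * x
    -x*-x≈x*x = begin
      - x * - x      ≈⟨ -‿distribˡ-* x (- x) ⟨
      - (x * - x)    ≈⟨ -‿cong (-‿distribʳ-* x x) ⟨
      - - (x * x)    ≈⟨ -‿involutive (x * x) ⟩
      x * x          ∎

  sameCubeCoset : ∀ {t t' a e} → a ≉ 0# → e ≉ 0# → t' * cube a ≈ t * cube e → SameCubeCoset t t'
  sameCubeCoset {t} {t'} {a} {e} a≉0 e≉0 eq with inverse a a≉0
  ... | a⁻¹ , aa⁻¹≈1 = e * a⁻¹ , *-nonzero e≉0 a⁻¹≉0 , sym (begin
      t * cube (e * a⁻¹)            ≈⟨ solve 3 (λ t e i → t :* ((e :* i) :* ((e :* i) :* (e :* i))) := (t :* (e :* (e :* e))) :* (i :* (i :* i))) refl t e a⁻¹ ⟩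
      (t * cube e) * cube a⁻¹       ≈⟨ *-congʳ eq ⟨
      (t' * cube a) * cube a⁻¹      ≈⟨ solve 3 (λ t a i → (t :* (a :* (a :* a))) :* (i :* (i :* i)) := t :* ((a :* i) :* ((a :* i) :* (a :* i)))) refl t' a a⁻¹ ⟩
      t' * cube (a * a⁻¹)           ≈⟨ *-congˡ (*-cong aa⁻¹≈1 (*-cong aa⁻¹≈1 aa⁻¹≈1)) ⟩
      t' * cube 1#                  ≈⟨ *-congˡ (trans (*-identityˡ _) (*-identityˡ 1#)) ⟩
      t' * 1#                       ≈⟨ *-identityʳ t' ⟩
      t'                            ∎)
    where
    a⁻¹≉0 : a⁻¹ ≉ 0#
    a⁻¹≉0 a⁻¹≈0 = 0≉1 (trans (sym (trans (*-congˡ a⁻¹≈0) (zeroʳ a))) aa⁻¹≈1)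

  sameCubeCoset-affine : ∀ {t t' a b c d} → a * d - b * c ≉ 0# → c ≈ 0# →
    b * (d * d) ≈ t' * (a * (c * c)) →
    b * (b * b) + t * (d * (d * d)) ≈ t' * (a * (a * a) + t * (c * (c * c))) →
    SameCubeCoset t t'
  sameCubeCoset-affine {t} {t'} {a} {b} {c} {d} det≉0 c≈0 H₀≈t'H₃ G₀≈t'G₃ =
    sameCubeCoset a≉0 d≉0 (sym td³≈t'a³)
    where
    c³≈0 : c * (c * c) ≈ 0#
    c³≈0 = x≈0⇒x*y≈0 c≈0
    ad≉0 : a * d ≉ 0#
    ad≉0 ad≈0 = det≉0 (begin
      a * d - b * c  ≈⟨ +-cong ad≈0 (-‿cong (y≈0⇒x*y≈0 c≈0)) ⟩
      0# - 0#        ≈⟨ -‿inverseʳ 0# ⟩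
      0#             ∎)
    a≉0 : a ≉ 0#
    a≉0 = x*y≉0⇒x≉0 ad≉0
    d≉0 : d ≉ 0#
    d≉0 = x*y≉0⇒y≉0 ad≉0
    b≈0 : b ≈ 0#
    b≈0 = x*y≈0⇒x≈0 (*-nonzero d≉0 d≉0) (begin
      b * (d * d)          ≈⟨ H₀≈t'H₃ ⟩
      t' * (a * (c * c))   ≈⟨ y≈0⇒x*y≈0 (y≈0⇒x*y≈0 (x≈0⇒x*y≈0 c≈0)) ⟩
      0#                   ∎)
    td³≈t'a³ : t * cube d ≈ t' * cube a
    td³≈t'a³ = begin
      t * (d * (d * d))                          ≈⟨ x≈0⇒x*y+z≈z (b * b) _ b≈0 ⟨
      b * (b * b) + t * (d * (d * d))            ≈⟨ G₀≈t'G₃ ⟩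
      t' * (a * (a * a) + t * (c * (c * c)))     ≈⟨ *-congˡ (y≈0⇒x+y≈x (y≈0⇒x*y≈0 c³≈0)) ⟩
      t' * (a * (a * a))                         ∎

  sameCubeCoset-nonaffine : ∀ {t t' a b c d} → a * d - b * c ≉ 0# → c ≉ 0# →
    c * (2# * (a * d) + b * c) ≈ 0# → b * (d * d) ≈ t' * (a * (c * c)) →
    3# * (a * (a * b) + t * (c * (c * d))) ≈ 0# →
    SameCubeCoset t t'
  sameCubeCoset-nonaffine {t} {t'} {a} {b} {c} {d} det≉0 c≉0 H₂≈0 H₀≈t'H₃ G₂≈0 =
    sameCubeCoset a≉0 -d≉0 t'a³≈t[-d]³
    where
    det≈3ad : a * d - b * c ≈ 3# * (a * d)
    det≈3ad = begin
      a * d - b * c                               ≈⟨ y≈0⇒x+y≈x (x*y≈0⇒y≈0 c≉0 H₂≈0) ⟨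
      (a * d - b * c) + (2# * (a * d) + b * c)    ≈⟨ solve 3 (λ x y -y → (x :+ -y) :+ (con 2 :* x :+ y) := con 3 :* x :+ (y :+ -y)) refl (a * d) (b * c) (- (b * c)) ⟩
      3# * (a * d) + (b * c - b * c)              ≈⟨ y≈0⇒x+y≈x (-‿inverseʳ (b * c)) ⟩
      3# * (a * d)                                ∎
    3ad≉0 : 3# * (a * d) ≉ 0#
    3ad≉0 3ad≈0 = det≉0 (trans det≈3ad 3ad≈0)
    a≉0 : a ≉ 0#
    a≉0 = x*y≉0⇒x≉0 (x*y≉0⇒y≉0 3ad≉0)
    -d≉0 : - d ≉ 0#
    -d≉0 -d≈0 = x*y≉0⇒y≉0 (x*y≉0⇒y≉0 3ad≉0) (trans (sym (-‿involutive d)) (trans (-‿cong -d≈0) -0#≈0#))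
    a²b+tc²d≈0 : a * (a * b) + t * (c * (c * d)) ≈ 0#
    a²b+tc²d≈0 = x*y≈0⇒y≈0 (x*y≉0⇒x≉0 3ad≉0) G₂≈0
    c³[t'a³+td³]≈0 : cube c * (t' * cube a + t * cube d) ≈ 0#
    c³[t'a³+td³]≈0 = begin
      cube c * (t' * cube a + t * cube d)
        ≈⟨ solve 5 (λ a c d t t' → (c :* (c :* c)) :* (t' :* (a :* (a :* a)) :+ t :* (d :* (d :* d)))
                     := (a :* a) :* c :* (t' :* (a :* (c :* c))) :+ c :* (d :* d) :* (t :* (c :* (c :* d)))) refl a c d t t' ⟩
      (a * a) * c * (t' * (a * (c * c))) + c * (d * d) * (t * (c * (c * d)))
        ≈⟨ +-congʳ (*-congˡ H₀≈t'H₃) ⟨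
      (a * a) * c * (b * (d * d)) + c * (d * d) * (t * (c * (c * d)))
        ≈⟨ solve 5 (λ a b c d t → (a :* a) :* c :* (b :* (d :* d)) :+ c :* (d :* d) :* (t :* (c :* (c :* d)))
                     := c :* (d :* d) :* (a :* (a :* b) :+ t :* (c :* (c :* d)))) refl a b c d t ⟩
      c * (d * d) * (a * (a * b) + t * (c * (c * d)))
        ≈⟨ *-congˡ a²b+tc²d≈0 ⟩
      c * (d * d) * 0#
        ≈⟨ zeroʳ _ ⟩
      0# ∎
    t'a³≈t[-d]³ : t' * cube a ≈ t * cube (- d)
    t'a³≈t[-d]³ = begin
      t' * cube a     ≈⟨ +-inverseˡ-unique _ _ (x*y≈0⇒y≈0 (*-nonzero c≉0 (*-nonzero c≉0 c≉0)) c³[t'a³+td³]≈0) ⟩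
      - (t * cube d)  ≈⟨ -‿distribʳ-* t (cube d) ⟩
      t * - cube d    ≈⟨ *-congˡ (cube-neg d) ⟨
      t * cube (- d)  ∎

  sameCubeCoset-of-coefficients : ∀ {t t' a b c d} → a * d - b * c ≉ 0# →
    c * (2# * (a * d) + b * c) ≈ 0# × b * (d * d) ≈ t' * (a * (c * c)) →
    3# * (a * (a * b) + t * (c * (c * d))) ≈ 0# ×
    b * (b * b) + t * (d * (d * d)) ≈ t' * (a * (a * a) + t * (c * (c * c))) →
    SameCubeCoset t t'
  sameCubeCoset-of-coefficients {c = c} det≉0 (H₂≈0 , H₀≈t'H₃) (G₂≈0 , G₀≈t'G₃) with c ≟ 0#
  ... | yes c≈0 = sameCubeCoset-affine det≉0 c≈0 H₀≈t'H₃ G₀≈t'G₃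
  ... | no  c≉0 = sameCubeCoset-nonaffine det≉0 c≉0 H₂≈0 H₀≈t'H₃ G₂≈0

module Polynomials {c ℓ : Level} (F : FiniteField c ℓ) where
  open RatFun F
  open FieldProperties F using (x*y≈0⇒y≈0; x≈0⇒x*y+z≈z)
  open RingProperties ring using (-1*x≈-x; x∙y⁻¹≈ε⇒x≈y)
  open CommutativeSemigroupProperties +-commutativeSemigroup using (x∙yz≈y∙xz; interchange)

  0ₚ 1ₚ : Poly
  0ₚ = constₚ 0#
  1ₚ = constₚ 1#

  ≈ₚ-isEquivalence : IsEquivalence _≈ₚ_
  ≈ₚ-isEquivalence = record
    { refl  = λ _ → refl
    ; sym   = λ p≈q n → sym (p≈q n)
    ; trans = λ p≈q q≈r n → trans (p≈q n) (q≈r n)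
    }

  ≈ₚ-setoid : Setoid c ℓ
  ≈ₚ-setoid = record { isEquivalence = ≈ₚ-isEquivalence }

  module ≈-Reasoning = SetoidReasoning setoid
  module ≈ₚ-Reasoning = SetoidReasoning ≈ₚ-setoid

  ∷-cong : ∀ {a b p q} → a ≈ b → p ≈ₚ q → (a ∷ p) ≈ₚ (b ∷ q)
  ∷-cong a≈b p≈q zero    = a≈b
  ∷-cong a≈b p≈q (suc n) = p≈q n

  ∷≈[] : ∀ {a p} → a ≈ 0# → p ≈ₚ [] → (a ∷ p) ≈ₚ []
  ∷≈[] a≈0 p≈0 zero    = a≈0
  ∷≈[] a≈0 p≈0 (suc n) = p≈0 n

  coeff-0ₚ : ∀ n → coeff 0ₚ n ≈ 0#
  coeff-0ₚ zero    = refl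
  coeff-0ₚ (suc n) = refl

  coeff-+ₚ : ∀ p q n → coeff (p +ₚ q) n ≈ coeff p n + coeff q n
  coeff-+ₚ []      q       n       = sym (+-identityˡ _)
  coeff-+ₚ (a ∷ p) []      n       = sym (+-identityʳ _)
  coeff-+ₚ (a ∷ p) (b ∷ q) zero    = refl
  coeff-+ₚ (a ∷ p) (b ∷ q) (suc n) = coeff-+ₚ p q n

  coeff-map-* : ∀ a p n → coeff (map (a *_) p) n ≈ a * coeff p n
  coeff-map-* a []      n       = sym (zeroʳ a)
  coeff-map-* a (b ∷ p) zero    = refl
  coeff-map-* a (b ∷ p) (suc n) = coeff-map-* a p n

  coeff-∷-*ₚ : ∀ a p q n → coeff ((a ∷ p) *ₚ q) n ≈ a * coeff q n + coeff (0# ∷ (p *ₚ q)) n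
  coeff-∷-*ₚ a p q n = trans (coeff-+ₚ (map (a *_) q) _ n) (+-congʳ (coeff-map-* a q n))

  coeff-*ₚ-∷ : ∀ p b q n → coeff (p *ₚ (b ∷ q)) n ≈ b * coeff p n + coeff (0# ∷ (p *ₚ q)) n
  coeff-*ₚ-∷ []      b q zero    = sym (trans (+-identityʳ _) (zeroʳ b))
  coeff-*ₚ-∷ []      b q (suc n) = sym (trans (+-identityʳ _) (zeroʳ b))
  coeff-*ₚ-∷ (a ∷ p) b q zero    = +-congʳ (*-comm a b)
  coeff-*ₚ-∷ (a ∷ p) b q (suc n) = begin
    coeff ((a ∷ p) *ₚ (b ∷ q)) (suc n)                 ≈⟨ coeff-∷-*ₚ a p (b ∷ q) (suc n) ⟩
    a * coeff q n + coeff (p *ₚ (b ∷ q)) n             ≈⟨ +-congˡ (coeff-*ₚ-∷ p b q n) ⟩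
    a * coeff q n + (b * coeff p n + coeff (0# ∷ (p *ₚ q)) n)
                                                       ≈⟨ x∙yz≈y∙xz _ _ _ ⟩
    b * coeff p n + (a * coeff q n + coeff (0# ∷ (p *ₚ q)) n)
                                                       ≈⟨ +-congˡ (coeff-∷-*ₚ a p q n) ⟨
    b * coeff (a ∷ p) (suc n) + coeff ((a ∷ p) *ₚ q) n ∎
    where open ≈-Reasoning

  +ₚ-cong : ∀ p p' q q' → p ≈ₚ p' → q ≈ₚ q' → (p +ₚ q) ≈ₚ (p' +ₚ q')
  +ₚ-cong p p' q q' p≈p' q≈q' n = begin
    coeff (p +ₚ q) n         ≈⟨ coeff-+ₚ p q n ⟩
    coeff p n + coeff q n    ≈⟨ +-cong (p≈p' n) (q≈q' n) ⟩
    coeff p' n + coeff q' n  ≈⟨ coeff-+ₚ p' q' n ⟨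
    coeff (p' +ₚ q') n       ∎
    where open ≈-Reasoning

  +ₚ-assoc : ∀ p q r → ((p +ₚ q) +ₚ r) ≈ₚ (p +ₚ (q +ₚ r))
  +ₚ-assoc p q r n = begin
    coeff ((p +ₚ q) +ₚ r) n                ≈⟨ trans (coeff-+ₚ (p +ₚ q) r n) (+-congʳ (coeff-+ₚ p q n)) ⟩
    (coeff p n + coeff q n) + coeff r n    ≈⟨ +-assoc _ _ _ ⟩
    coeff p n + (coeff q n + coeff r n)    ≈⟨ trans (coeff-+ₚ p (q +ₚ r) n) (+-congˡ (coeff-+ₚ q r n)) ⟨
    coeff (p +ₚ (q +ₚ r)) n                ∎
    where open ≈-Reasoning

  +ₚ-comm : ∀ p q → (p +ₚ q) ≈ₚ (q +ₚ p)
  +ₚ-comm p q n = trans (coeff-+ₚ p q n) (trans (+-comm _ _) (sym (coeff-+ₚ q p n)))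

  +ₚ-identityˡ : ∀ p → (0ₚ +ₚ p) ≈ₚ p
  +ₚ-identityˡ p n = trans (coeff-+ₚ 0ₚ p n) (trans (+-congʳ (coeff-0ₚ n)) (+-identityˡ _))

  *ₚ-[] : ∀ p → (p *ₚ []) ≈ₚ []
  *ₚ-[] []      n = refl
  *ₚ-[] (a ∷ p) n = begin
    coeff ((a ∷ p) *ₚ []) n                  ≈⟨ coeff-∷-*ₚ a p [] n ⟩
    a * 0# + coeff (0# ∷ (p *ₚ [])) n        ≈⟨ +-cong (zeroʳ a) (∷≈[] refl (*ₚ-[] p) n) ⟩
    0# + 0#                                  ≈⟨ +-identityʳ 0# ⟩
    0#                                       ∎
    where open ≈-Reasoning

  *ₚ-congʳ : ∀ p q q' → q ≈ₚ q' → (p *ₚ q) ≈ₚ (p *ₚ q')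
  *ₚ-congʳ []      q q' q≈q' n = refl
  *ₚ-congʳ (a ∷ p) q q' q≈q' n = begin
    coeff ((a ∷ p) *ₚ q) n                      ≈⟨ coeff-∷-*ₚ a p q n ⟩
    a * coeff q n + coeff (0# ∷ (p *ₚ q)) n     ≈⟨ +-cong (*-congˡ (q≈q' n)) (∷-cong refl (*ₚ-congʳ p q q' q≈q') n) ⟩
    a * coeff q' n + coeff (0# ∷ (p *ₚ q')) n   ≈⟨ coeff-∷-*ₚ a p q' n ⟨
    coeff ((a ∷ p) *ₚ q') n                     ∎
    where open ≈-Reasoning

  *ₚ-comm : ∀ p q → (p *ₚ q) ≈ₚ (q *ₚ p)
  *ₚ-comm []      q n = sym (*ₚ-[] q n)
  *ₚ-comm (a ∷ p) q n = begin
    coeff ((a ∷ p) *ₚ q) n                    ≈⟨ coeff-∷-*ₚ a p q n ⟩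
    a * coeff q n + coeff (0# ∷ (p *ₚ q)) n   ≈⟨ +-congˡ (∷-cong refl (*ₚ-comm p q) n) ⟩
    a * coeff q n + coeff (0# ∷ (q *ₚ p)) n   ≈⟨ coeff-*ₚ-∷ q a p n ⟨
    coeff (q *ₚ (a ∷ p)) n                    ∎
    where open ≈-Reasoning

  *ₚ-congˡ : ∀ p p' q → p ≈ₚ p' → (p *ₚ q) ≈ₚ (p' *ₚ q)
  *ₚ-congˡ p p' q p≈p' = begin
    p *ₚ q   ≈⟨ *ₚ-comm p q ⟩
    q *ₚ p   ≈⟨ *ₚ-congʳ q p p' p≈p' ⟩
    q *ₚ p'  ≈⟨ *ₚ-comm q p' ⟩
    p' *ₚ q  ∎
    where open ≈ₚ-Reasoning

  0∷-+ₚ : ∀ p q → (0# ∷ (p +ₚ q)) ≈ₚ ((0# ∷ p) +ₚ (0# ∷ q))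
  0∷-+ₚ p q = ∷-cong (sym (+-identityʳ 0#)) (λ _ → refl)

  *ₚ-distribˡ : ∀ p q r → (p *ₚ (q +ₚ r)) ≈ₚ ((p *ₚ q) +ₚ (p *ₚ r))
  *ₚ-distribˡ []      q r n = refl
  *ₚ-distribˡ (a ∷ p) q r n = begin
    coeff ((a ∷ p) *ₚ (q +ₚ r)) n
      ≈⟨ coeff-∷-*ₚ a p (q +ₚ r) n ⟩
    a * coeff (q +ₚ r) n + coeff (0# ∷ (p *ₚ (q +ₚ r))) n
      ≈⟨ +-cong (trans (*-congˡ (coeff-+ₚ q r n)) (distribˡ a _ _)) shifted ⟩
    (a * coeff q n + a * coeff r n) + (coeff (0# ∷ (p *ₚ q)) n + coeff (0# ∷ (p *ₚ r)) n)
      ≈⟨ interchange _ _ _ _ ⟩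
    (a * coeff q n + coeff (0# ∷ (p *ₚ q)) n) + (a * coeff r n + coeff (0# ∷ (p *ₚ r)) n)
      ≈⟨ +-cong (coeff-∷-*ₚ a p q n) (coeff-∷-*ₚ a p r n) ⟨
    coeff ((a ∷ p) *ₚ q) n + coeff ((a ∷ p) *ₚ r) n
      ≈⟨ coeff-+ₚ ((a ∷ p) *ₚ q) ((a ∷ p) *ₚ r) n ⟨
    coeff (((a ∷ p) *ₚ q) +ₚ ((a ∷ p) *ₚ r)) n
      ∎
    where
    open ≈-Reasoning
    shifted : coeff (0# ∷ (p *ₚ (q +ₚ r))) n ≈ coeff (0# ∷ (p *ₚ q)) n + coeff (0# ∷ (p *ₚ r)) n
    shifted = trans (∷-cong refl (*ₚ-distribˡ p q r) n)
                    (trans (0∷-+ₚ (p *ₚ q) (p *ₚ r) n) (coeff-+ₚ (0# ∷ (p *ₚ q)) (0# ∷ (p *ₚ r)) n))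

  *ₚ-distribʳ : ∀ r p q → ((p +ₚ q) *ₚ r) ≈ₚ ((p *ₚ r) +ₚ (q *ₚ r))
  *ₚ-distribʳ r p q = begin
    (p +ₚ q) *ₚ r              ≈⟨ *ₚ-comm (p +ₚ q) r ⟩
    r *ₚ (p +ₚ q)              ≈⟨ *ₚ-distribˡ r p q ⟩
    (r *ₚ p) +ₚ (r *ₚ q)       ≈⟨ +ₚ-cong (r *ₚ p) (p *ₚ r) (r *ₚ q) (q *ₚ r) (*ₚ-comm r p) (*ₚ-comm r q) ⟩
    (p *ₚ r) +ₚ (q *ₚ r)       ∎
    where open ≈ₚ-Reasoning

  map-*-*ₚ : ∀ a p q → (map (a *_) p *ₚ q) ≈ₚ map (a *_) (p *ₚ q)
  map-*-*ₚ a []      q n = refl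
  map-*-*ₚ a (b ∷ p) q n = begin
    coeff (map (a *_) (b ∷ p) *ₚ q) n
      ≈⟨ coeff-∷-*ₚ (a * b) (map (a *_) p) q n ⟩
    (a * b) * coeff q n + coeff (0# ∷ (map (a *_) p *ₚ q)) n
      ≈⟨ +-cong (*-assoc a b _) shifted ⟩
    a * (b * coeff q n) + a * coeff (0# ∷ (p *ₚ q)) n
      ≈⟨ distribˡ a _ _ ⟨
    a * (b * coeff q n + coeff (0# ∷ (p *ₚ q)) n)
      ≈⟨ *-congˡ (coeff-∷-*ₚ b p q n) ⟨
    a * coeff ((b ∷ p) *ₚ q) n
      ≈⟨ coeff-map-* a ((b ∷ p) *ₚ q) n ⟨
    coeff (map (a *_) ((b ∷ p) *ₚ q)) n
      ∎
    where
    open ≈-Reasoning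
    shifted : coeff (0# ∷ (map (a *_) p *ₚ q)) n ≈ a * coeff (0# ∷ (p *ₚ q)) n
    shifted = trans (∷-cong (sym (zeroʳ a)) (map-*-*ₚ a p q) n) (coeff-map-* a (0# ∷ (p *ₚ q)) n)

  0∷-*ₚ : ∀ p q → ((0# ∷ p) *ₚ q) ≈ₚ (0# ∷ (p *ₚ q))
  0∷-*ₚ p q n = trans (coeff-∷-*ₚ 0# p q n) (trans (+-congʳ (zeroˡ _)) (+-identityˡ _))

  *ₚ-assoc : ∀ p q r → ((p *ₚ q) *ₚ r) ≈ₚ (p *ₚ (q *ₚ r))
  *ₚ-assoc []      q r n = refl
  *ₚ-assoc (a ∷ p) q r n = begin
    coeff ((map (a *_) q +ₚ (0# ∷ (p *ₚ q))) *ₚ r) n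
      ≈⟨ *ₚ-distribʳ r (map (a *_) q) (0# ∷ (p *ₚ q)) n ⟩
    coeff ((map (a *_) q *ₚ r) +ₚ ((0# ∷ (p *ₚ q)) *ₚ r)) n
      ≈⟨ coeff-+ₚ (map (a *_) q *ₚ r) ((0# ∷ (p *ₚ q)) *ₚ r) n ⟩
    coeff (map (a *_) q *ₚ r) n + coeff ((0# ∷ (p *ₚ q)) *ₚ r) n
      ≈⟨ +-cong (map-*-*ₚ a q r n) (trans (0∷-*ₚ (p *ₚ q) r n) (∷-cong refl (*ₚ-assoc p q r) n)) ⟩
    coeff (map (a *_) (q *ₚ r)) n + coeff (0# ∷ (p *ₚ (q *ₚ r))) n
      ≈⟨ coeff-+ₚ (map (a *_) (q *ₚ r)) (0# ∷ (p *ₚ (q *ₚ r))) n ⟨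
    coeff (map (a *_) (q *ₚ r) +ₚ (0# ∷ (p *ₚ (q *ₚ r)))) n
      ∎
    where open ≈-Reasoning

  *ₚ-identityˡ : ∀ p → (1ₚ *ₚ p) ≈ₚ p
  *ₚ-identityˡ p n = trans (coeff-∷-*ₚ 1# [] p n) (trans (+-cong (*-identityˡ _) (coeff-0ₚ n)) (+-identityʳ _))

  *ₚ-zeroʳ : ∀ p → (p *ₚ 0ₚ) ≈ₚ 0ₚ
  *ₚ-zeroʳ p n = begin
    coeff (p *ₚ 0ₚ) n                        ≈⟨ coeff-*ₚ-∷ p 0# [] n ⟩
    0# * coeff p n + coeff (0# ∷ (p *ₚ [])) n ≈⟨ +-cong (zeroˡ _) (∷≈[] refl (*ₚ-[] p) n) ⟩
    0# + 0#                                  ≈⟨ +-identityʳ 0# ⟩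
    0#                                       ≈⟨ coeff-0ₚ n ⟨
    coeff 0ₚ n                               ∎
    where open ≈-Reasoning

  commutativeSemiringₚ : CommutativeSemiring c ℓ
  commutativeSemiringₚ = record
    { Carrier               = Poly
    ; _≈_                   = _≈ₚ_
    ; _+_                   = _+ₚ_
    ; _*_                   = _*ₚ_
    ; 0#                    = 0ₚ
    ; 1#                    = 1ₚ
    ; isCommutativeSemiring = IsCommutativeSemiringʳ.isCommutativeSemiring record
      { +-isCommutativeMonoid = isCommutativeMonoidˡ record
        { isSemigroup = record
          { isMagma = record { isEquivalence = ≈ₚ-isEquivalence ; ∙-cong = λ {p} {p'} {q} {q'} → +ₚ-cong p p' q q' }
          ; assoc   = +ₚ-assoc
          }
        ; identityˡ = +ₚ-identityˡ
        ; comm      = +ₚ-comm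
        }
      ; *-isCommutativeMonoid = isCommutativeMonoidˡ record
        { isSemigroup = record
          { isMagma = record { isEquivalence = ≈ₚ-isEquivalence ; ∙-cong = λ {p} {p'} {q} → *ₚ-cong {p} {p'} {q} }
          ; assoc   = *ₚ-assoc
          }
        ; identityˡ = *ₚ-identityˡ
        ; comm      = *ₚ-comm
        }
      ; distribˡ = *ₚ-distribˡ
      ; zeroʳ    = *ₚ-zeroʳ
      }
    }
    where
    *ₚ-cong : ∀ {p p' q q'} → p ≈ₚ p' → q ≈ₚ q' → (p *ₚ q) ≈ₚ (p' *ₚ q')
    *ₚ-cong {p} {p'} {q} {q'} p≈p' q≈q' = begin
      p *ₚ q    ≈⟨ *ₚ-congˡ p p' q p≈p' ⟩
      p' *ₚ q   ≈⟨ *ₚ-congʳ p' q q' q≈q' ⟩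
      p' *ₚ q'  ∎
      where open ≈ₚ-Reasoning

  [a∷p]*ₚq≈[]⇒q≈[] : ∀ a p q → a ≉ 0# → ((a ∷ p) *ₚ q) ≈ₚ [] → q ≈ₚ []
  [a∷p]*ₚq≈[]⇒q≈[] a p []      a≉0 apq≈0 n = refl
  [a∷p]*ₚq≈[]⇒q≈[] a p (b ∷ q) a≉0 apq≈0   = ∷≈[] b≈0 ([a∷p]*ₚq≈[]⇒q≈[] a p q a≉0 apq≈0')
    where
    b≈0 : b ≈ 0#
    b≈0 = x*y≈0⇒y≈0 a≉0 (trans (sym (+-identityʳ (a * b))) (apq≈0 0))
    apq≈0' : ((a ∷ p) *ₚ q) ≈ₚ []
    apq≈0' n = begin
      coeff ((a ∷ p) *ₚ q) n                                ≈⟨ x≈0⇒x*y+z≈z _ _ b≈0 ⟨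
      b * coeff (a ∷ p) (suc n) + coeff ((a ∷ p) *ₚ q) n    ≈⟨ coeff-*ₚ-∷ (a ∷ p) b q (suc n) ⟨
      coeff ((a ∷ p) *ₚ (b ∷ q)) (suc n)                    ≈⟨ apq≈0 (suc n) ⟩
      0#                                                    ∎
      where open ≈-Reasoning

  p*ₚq≈[]⇒q≈[] : ∀ p q → ¬ (p ≈ₚ []) → (p *ₚ q) ≈ₚ [] → q ≈ₚ []
  p*ₚq≈[]⇒q≈[] []      q p≉0 pq≈0 = contradiction (λ _ → refl) p≉0
  p*ₚq≈[]⇒q≈[] (a ∷ p) q p≉0 apq≈0 with a ≟ 0#
  ... | no  a≉0 = [a∷p]*ₚq≈[]⇒q≈[] a p q a≉0 apq≈0
  ... | yes a≈0 = p*ₚq≈[]⇒q≈[] p q (p≉0 ∘ ∷≈[] a≈0) pq≈0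
    where
    pq≈0 : (p *ₚ q) ≈ₚ []
    pq≈0 n = begin
      coeff (p *ₚ q) n                              ≈⟨ x≈0⇒x*y+z≈z _ _ a≈0 ⟨
      a * coeff q (suc n) + coeff (p *ₚ q) n        ≈⟨ coeff-∷-*ₚ a p q (suc n) ⟨
      coeff ((a ∷ p) *ₚ q) (suc n)                  ≈⟨ apq≈0 (suc n) ⟩
      0#                                            ∎
      where open ≈-Reasoning

  coeff-*ₚ-map-* : ∀ p a q n → coeff (p *ₚ map (a *_) q) n ≈ a * coeff (p *ₚ q) n
  coeff-*ₚ-map-* p a q n = begin
    coeff (p *ₚ map (a *_) q) n    ≈⟨ *ₚ-comm p (map (a *_) q) n ⟩
    coeff (map (a *_) q *ₚ p) n    ≈⟨ map-*-*ₚ a q p n ⟩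
    coeff (map (a *_) (q *ₚ p)) n  ≈⟨ coeff-map-* a (q *ₚ p) n ⟩
    a * coeff (q *ₚ p) n           ≈⟨ *-congˡ (*ₚ-comm q p n) ⟩
    a * coeff (p *ₚ q) n           ∎
    where open ≈-Reasoning

  *ₚ-cancelˡ : ∀ k p q → ¬ (k ≈ₚ []) → (k *ₚ p) ≈ₚ (k *ₚ q) → p ≈ₚ q
  *ₚ-cancelˡ k p q k≉0 kp≈kq n = x∙y⁻¹≈ε⇒x≈y _ _ (begin
    coeff p n - coeff q n                  ≈⟨ +-congˡ (-1*x≈-x _) ⟨
    coeff p n + - 1# * coeff q n           ≈⟨ trans (coeff-+ₚ p _ n) (+-congˡ (coeff-map-* (- 1#) q n)) ⟨
    coeff (p +ₚ map (- 1# *_) q) n         ≈⟨ p*ₚq≈[]⇒q≈[] k _ k≉0 k[p-q]≈0 n ⟩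
    0#                                     ∎)
    where
    open ≈-Reasoning
    k[p-q]≈0 : (k *ₚ (p +ₚ map (- 1# *_) q)) ≈ₚ []
    k[p-q]≈0 n = begin
      coeff (k *ₚ (p +ₚ map (- 1# *_) q)) n              ≈⟨ trans (*ₚ-distribˡ k p _ n) (coeff-+ₚ (k *ₚ p) _ n) ⟩
      coeff (k *ₚ p) n + coeff (k *ₚ map (- 1# *_) q) n  ≈⟨ +-cong (kp≈kq n) (coeff-*ₚ-map-* k (- 1#) q n) ⟩
      coeff (k *ₚ q) n + - 1# * coeff (k *ₚ q) n         ≈⟨ +-congˡ (-1*x≈-x _) ⟩
      coeff (k *ₚ q) n - coeff (k *ₚ q) n                ≈⟨ -‿inverseʳ _ ⟩
      0#                                                 ∎

  *ₚ-nonzero : ∀ p q → ¬ (p ≈ₚ []) → ¬ (q ≈ₚ []) → ¬ ((p *ₚ q) ≈ₚ [])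
  *ₚ-nonzero p q p≉0 q≉0 pq≈0 = q≉0 (p*ₚq≈[]⇒q≈[] p q p≉0 pq≈0)

module CubicComposite {c ℓ : Level} (F : FiniteField c ℓ) where
  open RatFun F
  open FieldProperties F using (x≈0⇒x*y≈0; y≈0⇒x*y≈0)
  open Polynomials F
  private
    module PS = NaturalCoefficientsSolver commutativeSemiringₚ
    open PS using (con; _:+_; _:*_; _:=_)
    open Syntax {A = PS.Polynomial 7} (con 0) (con 1) _:+_ _:*_ using (Fracˢ; cubeᴬ; _∘ᶠˢ_)

    compositeˢ : (t u v A B C D : PS.Polynomial 7) → Fracˢ
    compositeˢ t u v A B C D =
      ((B ∷ A ∷ []) , (D ∷ C ∷ [])) ∘ᶠˢ (((t ∷ con 0 ∷ con 0 ∷ con 1 ∷ []) , (con 0 ∷ con 1 ∷ [])) ∘ᶠˢ (u , v))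

    cubicNumˢ : (t u v : PS.Polynomial 7) → PS.Polynomial 7
    cubicNumˢ t u v = cubeᴬ u :+ t :* cubeᴬ v

    cubicDenˢ commonFactorˢ : (u v : PS.Polynomial 7) → PS.Polynomial 7
    cubicDenˢ     u v = u :* (v :* v)
    commonFactorˢ u v = cubeᴬ (u :* cubeᴬ (v :* v))

  cubeₚ : Poly → Poly
  cubeₚ p = p *ₚ (p *ₚ p)

  cubicNum : Carrier → Frac → Poly
  cubicNum t (u , v) = cubeₚ u +ₚ (constₚ t *ₚ cubeₚ v)

  cubicDen : Frac → Poly
  cubicDen (u , v) = u *ₚ (v *ₚ v)

  mobiusNum mobiusDen : Mobius → Poly → Poly → Poly
  mobiusNum (mob a b _ _ _) g h = (constₚ a *ₚ g) +ₚ (constₚ b *ₚ h)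
  mobiusDen (mob _ _ c d _) g h = (constₚ c *ₚ g) +ₚ (constₚ d *ₚ h)

  -- Composition in Defs never cancels, so ψ ∘ f ∘ (u / v) carries this factor in numerator and denominator.
  commonFactor : Frac → Poly
  commonFactor (u , v) = cubeₚ (u *ₚ cubeₚ (v *ₚ v))

  composite-num : ∀ t ψ g → num (toFrac ψ ∘ᶠ (cubicFrac t ∘ᶠ g)) ≈ₚ
                            (commonFactor g *ₚ mobiusNum ψ (cubicNum t g) (cubicDen g))
  composite-num t (mob A B C D _) (u , v) = PS.solve 7 (λ t u v A B C D →
      proj₁ (compositeˢ t u v A B C D)
        := commonFactorˢ u v :* (A :* cubicNumˢ t u v :+ B :* cubicDenˢ u v))
    (λ _ → refl) (constₚ t) u v (constₚ A) (constₚ B) (constₚ C) (constₚ D)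

  composite-den : ∀ t ψ g → den (toFrac ψ ∘ᶠ (cubicFrac t ∘ᶠ g)) ≈ₚ
                            (commonFactor g *ₚ mobiusDen ψ (cubicNum t g) (cubicDen g))
  composite-den t (mob A B C D _) (u , v) = PS.solve 7 (λ t u v A B C D →
      proj₂ (compositeˢ t u v A B C D)
        := commonFactorˢ u v :* (C :* cubicNumˢ t u v :+ D :* cubicDenˢ u v))
    (λ _ → refl) (constₚ t) u v (constₚ A) (constₚ B) (constₚ C) (constₚ D)

  num-toFrac-nonzero : ∀ φ → ¬ (num (toFrac φ) ≈ₚ [])
  num-toFrac-nonzero (mob a b c d det≉0) u≈0 = det≉0 (begin
    a * d - b * c  ≈⟨ +-cong (x≈0⇒x*y≈0 (u≈0 1)) (-‿cong (x≈0⇒x*y≈0 (u≈0 0))) ⟩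
    0# - 0#        ≈⟨ -‿inverseʳ 0# ⟩
    0#             ∎)
    where open ≈-Reasoning

  den-toFrac-nonzero : ∀ φ → ¬ (den (toFrac φ) ≈ₚ [])
  den-toFrac-nonzero (mob a b c d det≉0) v≈0 = det≉0 (begin
    a * d - b * c  ≈⟨ +-cong (y≈0⇒x*y≈0 (v≈0 0)) (-‿cong (y≈0⇒x*y≈0 (v≈0 1))) ⟩
    0# - 0#        ≈⟨ -‿inverseʳ 0# ⟩
    0#             ∎)
    where open ≈-Reasoning

  commonFactor-nonzero : ∀ φ → ¬ (commonFactor (toFrac φ) ≈ₚ [])
  commonFactor-nonzero φ = cube≉0 (u *ₚ cubeₚ (v *ₚ v))
    (*ₚ-nonzero u (cubeₚ (v *ₚ v)) (num-toFrac-nonzero φ) (cube≉0 (v *ₚ v) (*ₚ-nonzero v v v≉0 v≉0)))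
    where
    u v : Poly
    u = num (toFrac φ)
    v = den (toFrac φ)
    v≉0 : ¬ (v ≈ₚ [])
    v≉0 = den-toFrac-nonzero φ
    cube≉0 : ∀ p → ¬ (p ≈ₚ []) → ¬ (cubeₚ p ≈ₚ [])
    cube≉0 p p≉0 = *ₚ-nonzero p (p *ₚ p) p≉0 (*ₚ-nonzero p p p≉0 p≉0)

  ≈ᶠ-cancel-common : ∀ f g k n d → ¬ (k ≈ₚ []) → num g ≈ₚ (k *ₚ n) → den g ≈ₚ (k *ₚ d) →
                     f ≈ᶠ g → f ≈ᶠ (n , d)
  ≈ᶠ-cancel-common (n₁ , d₁) (n₂ , d₂) k n d k≉0 n₂≈kn d₂≈kd f≈g =
    *ₚ-cancelˡ k (n₁ *ₚ d) (n *ₚ d₁) k≉0 (begin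
      k *ₚ (n₁ *ₚ d)   ≈⟨ PS.solve 3 (λ k n₁ d → k :* (n₁ :* d) := n₁ :* (k :* d)) (λ _ → refl) k n₁ d ⟩
      n₁ *ₚ (k *ₚ d)   ≈⟨ *ₚ-congʳ n₁ d₂ (k *ₚ d) d₂≈kd ⟨
      n₁ *ₚ d₂         ≈⟨ f≈g ⟩
      n₂ *ₚ d₁         ≈⟨ *ₚ-congˡ n₂ (k *ₚ n) d₁ n₂≈kn ⟩
      (k *ₚ n) *ₚ d₁   ≈⟨ *ₚ-assoc k n d₁ ⟩
      k *ₚ (n *ₚ d₁)   ∎)
    where open ≈ₚ-Reasoning

module CubicSpan {c ℓ : Level} (F : FiniteField c ℓ) where
  open RatFun F
  open FieldProperties F
  open CubeCosets F using (2#; 3#)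
  open Polynomials F
  open CubicComposite F using (cubicNum; cubicDen; mobiusNum; mobiusDen)
  private
    module CS = NaturalCoefficientsSolver commutativeSemiring
    open CS using (solve; con; _:+_; _:*_; _:=_)
    open module Syntaxₙ {n} = Syntax {A = CS.Polynomial n} (con 0) (con 1) _:+_ _:*_ using (_+ˢ_; _*ˢ_; cubeˢ; coeffˢ)
  open SetoidReasoning setoid

  Degree≤ : ℕ → Poly → Set ℓ
  Degree≤ d p = ∀ n → coeff p (suc (d ℕ.+ n)) ≈ 0#

  -- For p of degree at most 3: p lies in the span of X and X³ + t.
  InSpan : Carrier → Poly → Set ℓ
  InSpan t p = coeff p 2 ≈ 0# × coeff p 0 ≈ t * coeff p 3

  X*ₚ : ∀ p → ((0# ∷ 1# ∷ []) *ₚ p) ≈ₚ (0# ∷ p)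
  X*ₚ p n = trans (0∷-*ₚ 1ₚ p n) (∷-cong refl (*ₚ-identityˡ p) n)

  coeff-[X³+t]*ₚ : ∀ t p n → coeff (num (cubicFrac t) *ₚ p) n ≈ t * coeff p n + coeff (0# ∷ 0# ∷ 0# ∷ p) n
  coeff-[X³+t]*ₚ t p n = trans (coeff-∷-*ₚ t (0# ∷ 0# ∷ 1# ∷ []) p n) (+-congˡ (∷-cong refl X²*p n))
    where
    X²*p : ((0# ∷ 0# ∷ 1# ∷ []) *ₚ p) ≈ₚ (0# ∷ 0# ∷ p)
    X²*p m = trans (0∷-*ₚ (0# ∷ 1# ∷ []) p m) (∷-cong refl (X*ₚ p) m)

  inSpan-of-≈ᶠ : ∀ {t} r s → t ≉ 0# → Degree≤ 3 r → Degree≤ 3 s →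
                 cubicFrac t ≈ᶠ (r , s) → InSpan t r × InSpan t s
  inSpan-of-≈ᶠ {t} r s t≉0 deg-r deg-s eq = (r₂≈0 , r₀≈tr₃) , (s₂≈0 , s₀≈ts₃)
    where
    coeffₙ : ∀ n → t * coeff s n + coeff (0# ∷ 0# ∷ 0# ∷ s) n ≈ coeff (0# ∷ r) n
    coeffₙ n = trans (sym (coeff-[X³+t]*ₚ t s n)) (trans (eq n) (trans (*ₚ-comm r _ n) (X*ₚ r n)))
    s₀≈0 : coeff s 0 ≈ 0#
    s₀≈0 = x*y≈0⇒y≈0 t≉0 (trans (sym (+-identityʳ _)) (coeffₙ 0))
    s₃≈0 : coeff s 3 ≈ 0#
    s₃≈0 = begin
      coeff s 3                   ≈⟨ y≈0⇒x*y+z≈z t _ (deg-s 2) ⟨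
      t * coeff s 6 + coeff s 3   ≈⟨ coeffₙ 6 ⟩
      coeff r 5                   ≈⟨ deg-r 1 ⟩
      0#                          ∎
    s₂≈0 : coeff s 2 ≈ 0#
    s₂≈0 = begin
      coeff s 2                   ≈⟨ y≈0⇒x*y+z≈z t _ (deg-s 1) ⟨
      t * coeff s 5 + coeff s 2   ≈⟨ coeffₙ 5 ⟩
      coeff r 4                   ≈⟨ deg-r 0 ⟩
      0#                          ∎
    s₀≈ts₃ : coeff s 0 ≈ t * coeff s 3
    s₀≈ts₃ = trans s₀≈0 (sym (trans (*-congˡ s₃≈0) (zeroʳ t)))
    r₂≈0 : coeff r 2 ≈ 0#
    r₂≈0 = begin
      coeff r 2                   ≈⟨ coeffₙ 3 ⟨
      t * coeff s 3 + coeff s 0   ≈⟨ y≈0⇒x*y+z≈z t _ s₃≈0 ⟩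
      coeff s 0                   ≈⟨ s₀≈0 ⟩
      0#                          ∎
    r₀≈tr₃ : coeff r 0 ≈ t * coeff r 3
    r₀≈tr₃ = begin
      coeff r 0                   ≈⟨ coeffₙ 1 ⟨
      t * coeff s 1 + 0#          ≈⟨ +-identityʳ _ ⟩
      t * coeff s 1               ≈⟨ *-congˡ (trans (sym (y≈0⇒x*y+z≈z t _ (deg-s 0))) (coeffₙ 4)) ⟩
      t * coeff r 3               ∎

  coeff-constₚ-*ₚ : ∀ x p n → coeff (constₚ x *ₚ p) n ≈ x * coeff p n
  coeff-constₚ-*ₚ x p n = trans (coeff-∷-*ₚ x [] p n) (trans (+-congˡ (coeff-0ₚ n)) (+-identityʳ _))

  coeff-linear : ∀ x p y q n → coeff ((constₚ x *ₚ p) +ₚ (constₚ y *ₚ q)) n ≈ x * coeff p n + y * coeff q n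
  coeff-linear x p y q n = trans (coeff-+ₚ (constₚ x *ₚ p) (constₚ y *ₚ q) n) (+-cong (coeff-constₚ-*ₚ x p n) (coeff-constₚ-*ₚ y q n))

  inSpan-of-mobius : ∀ {t} ψ g h → InSpan t (mobiusNum ψ g h) → InSpan t (mobiusDen ψ g h) →
                     InSpan t g × InSpan t h
  inSpan-of-mobius {t} (mob A B C D det≉0) g h (T₂≈0 , T₀≈tT₃) (S₂≈0 , S₀≈tS₃) =
    (proj₁ at₂ , proj₁ at₀₃) , (proj₂ at₂ , proj₂ at₀₃)
    where
    row₂ : ∀ x y → coeff ((constₚ x *ₚ g) +ₚ (constₚ y *ₚ h)) 2 ≈ 0# →
           x * coeff g 2 + y * coeff h 2 ≈ x * 0# + y * 0#
    row₂ x y eq = begin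
      x * coeff g 2 + y * coeff h 2  ≈⟨ coeff-linear x g y h 2 ⟨
      _                              ≈⟨ eq ⟩
      0#                             ≈⟨ +-identityʳ 0# ⟨
      0# + 0#                        ≈⟨ +-cong (zeroʳ x) (zeroʳ y) ⟨
      x * 0# + y * 0#                ∎
    row₀₃ : ∀ x y → let p = (constₚ x *ₚ g) +ₚ (constₚ y *ₚ h) in coeff p 0 ≈ t * coeff p 3 →
            x * coeff g 0 + y * coeff h 0 ≈ x * (t * coeff g 3) + y * (t * coeff h 3)
    row₀₃ x y eq = begin
      x * coeff g 0 + y * coeff h 0              ≈⟨ coeff-linear x g y h 0 ⟨
      _                                          ≈⟨ eq ⟩
      t * _                                      ≈⟨ *-congˡ (coeff-linear x g y h 3) ⟩
      t * (x * coeff g 3 + y * coeff h 3)        ≈⟨ solve 5 (λ t x y g h → t :* (x :* g :+ y :* h) := x :* (t :* g) :+ y :* (t :* h)) refl t x y _ _ ⟩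
      x * (t * coeff g 3) + y * (t * coeff h 3)  ∎
    at₂ : coeff g 2 ≈ 0# × coeff h 2 ≈ 0#
    at₂ = linear-injective det≉0 (row₂ A B T₂≈0) (row₂ C D S₂≈0)
    at₀₃ : coeff g 0 ≈ t * coeff g 3 × coeff h 0 ≈ t * coeff h 3
    at₀₃ = linear-injective det≉0 (row₀₃ A B T₀≈tT₃) (row₀₃ C D S₀≈tS₃)

  inSpan-cubicDen : ∀ {t'} a b c d → InSpan t' (cubicDen (b ∷ a ∷ [] , d ∷ c ∷ [])) →
                    c * (2# * (a * d) + b * c) ≈ 0# × b * (d * d) ≈ t' * (a * (c * c))
  inSpan-cubicDen {t'} a b c d (H₂≈0 , H₀≈t'H₃) =
    trans (sym H₂) H₂≈0 , trans (sym H₀) (trans H₀≈t'H₃ (*-congˡ H₃))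
    where
    H : Poly
    H = cubicDen (b ∷ a ∷ [] , d ∷ c ∷ [])
    Hˢ : ∀ {n} (a b c d : CS.Polynomial n) → ℕ → CS.Polynomial n
    Hˢ a b c d = coeffˢ ((b ∷ a ∷ []) *ˢ ((d ∷ c ∷ []) *ˢ (d ∷ c ∷ [])))
    H₀ : coeff H 0 ≈ b * (d * d)
    H₀ = solve 4 (λ a b c d → Hˢ a b c d 0 := b :* (d :* d)) refl a b c d
    H₂ : coeff H 2 ≈ c * (2# * (a * d) + b * c)
    H₂ = solve 4 (λ a b c d → Hˢ a b c d 2 := c :* (con 2 :* (a :* d) :+ b :* c)) refl a b c d
    H₃ : coeff H 3 ≈ a * (c * c)
    H₃ = solve 4 (λ a b c d → Hˢ a b c d 3 := a :* (c :* c)) refl a b c d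

  inSpan-cubicNum : ∀ {t t'} a b c d → InSpan t' (cubicNum t (b ∷ a ∷ [] , d ∷ c ∷ [])) →
                    3# * (a * (a * b) + t * (c * (c * d))) ≈ 0# ×
                    b * (b * b) + t * (d * (d * d)) ≈ t' * (a * (a * a) + t * (c * (c * c)))
  inSpan-cubicNum {t} {t'} a b c d (G₂≈0 , G₀≈t'G₃) =
    trans (sym G₂) G₂≈0 , trans (sym G₀) (trans G₀≈t'G₃ (*-congˡ G₃))
    where
    G : Poly
    G = cubicNum t (b ∷ a ∷ [] , d ∷ c ∷ [])
    Gˢ : ∀ {n} (a b c d t : CS.Polynomial n) → ℕ → CS.Polynomial n
    Gˢ a b c d t = coeffˢ (cubeˢ (b ∷ a ∷ []) +ˢ ((t ∷ []) *ˢ cubeˢ (d ∷ c ∷ [])))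
    G₀ : coeff G 0 ≈ b * (b * b) + t * (d * (d * d))
    G₀ = solve 5 (λ a b c d t → Gˢ a b c d t 0 := b :* (b :* b) :+ t :* (d :* (d :* d))) refl a b c d t
    G₂ : coeff G 2 ≈ 3# * (a * (a * b) + t * (c * (c * d)))
    G₂ = solve 5 (λ a b c d t → Gˢ a b c d t 2 := con 3 :* (a :* (a :* b) :+ t :* (c :* (c :* d)))) refl a b c d t
    G₃ : coeff G 3 ≈ a * (a * a) + t * (c * (c * c))
    G₃ = solve 5 (λ a b c d t → Gˢ a b c d t 3 := a :* (a :* a) :+ t :* (c :* (c :* c))) refl a b c d t

module CubicEquivalence {c ℓ : Level} (F : FiniteField c ℓ) where
  open RatFun F
  open CubicComposite F
  open CubicSpan F
  open CubeCosets F using (sameCubeCoset-of-coefficients)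

  equivalent⇒sameCubeCoset : ∀ {t t'} → t' ≉ 0# → Equivalent (cubicFrac t) (cubicFrac t') → SameCubeCoset t t'
  equivalent⇒sameCubeCoset {t} {t'} t'≉0 (ψ , φ@(mob a b c d det≉0) , t'≈ψ∘t∘φ) =
    let T-span , S-span = inSpan-of-≈ᶠ T S t'≉0 (λ _ → refl) (λ _ → refl) cleared
        G-span , H-span = inSpan-of-mobius ψ G H T-span S-span
    in sameCubeCoset-of-coefficients det≉0 (inSpan-cubicDen a b c d H-span) (inSpan-cubicNum a b c d G-span)
    where
    G H T S : Poly
    G = cubicNum t (toFrac φ)
    H = cubicDen (toFrac φ)
    T = mobiusNum ψ G H
    S = mobiusDen ψ G H
    cleared : cubicFrac t' ≈ᶠ (T , S)
    cleared = ≈ᶠ-cancel-common (cubicFrac t') (toFrac ψ ∘ᶠ (cubicFrac t ∘ᶠ toFrac φ)) (commonFactor (toFrac φ)) T S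
      (commonFactor-nonzero φ)
      (composite-num t ψ (toFrac φ)) (composite-den t ψ (toFrac φ)) t'≈ψ∘t∘φ

proposition3p2 : ∀ {c ℓ p : Level} (F : FiniteField c ℓ) → let open RatFun F in
    (𝒞 : Carrier → Set p) → CubeCosetReps 𝒞 → ∀ t t' → 𝒞 t → 𝒞 t' →
    Equivalent (cubicFrac t) (cubicFrac t') → t ≈ t'
proposition3p2 F 𝒞 reps t t' 𝒞t 𝒞t' equivalent =
  reps-unique t t' 𝒞t 𝒞t' (equivalent⇒sameCubeCoset (reps-nonzero t' 𝒞t') equivalent)
  where
  open RatFun F using (module CubeCosetReps)
  open CubeCosetReps reps
  open CubicEquivalence F
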